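{- Let $\mathcal{U}^{\leq 0}$ be a univalent universe of sets ($0$-truncated types), let $(S,\mathrm{Pos})$ be a $\mathcal{U}^{\leq 0}$-indexed container that retains $0$-truncation, and let $P = \lambda X.\bot$ be the constantly false family. Then $\mathsf V = \sum_{X:\mathcal U^{\leq 0}}\mathrm{inV}(X)$ is $0$-truncated.
   Context: Work in homotopy type theory with function extensionality and higher inductive families. An $I$-indexed container is a pair $(S,\mathrm{Pos})$ of a family $S$ over $I$ and a family $\mathrm{Pos}$ over $\sum_{i:I} S(i)\times I$; its extension is $\mathrm{Ext}(F)(i) = \sum_{s:S(i)}\prod_{j:I}\mathrm{Pos}(i,s,j)\to F(j)$. The container retains $0$-truncation if for any family $F$ over $I$ and $(s_b,t_b):\mathrm{Ext}(F)(i_b)$ ($b\in\{0,1\}$): whenever for all $j_0,j_1$ and positions $p_0:\mathrm{Pos}(i_0,s_0,j_0)$, $p_1:\mathrm{Pos}(i_1,s_1,j_1)$ the type $\sum_{q:j_0=j_1}(t_0(j_0)(p_0) =_{F(q)} t_1(j_1)(p_1))$ is a proposition, the identity type $(i_0,s_0,t_0)=(i_1,s_1,t_1)$ in $\sum_i\mathrm{Ext}(F)(i)$ is a proposition (here $=_{F(q)}$ is equality after transport along $q$). The family $\mathrm{inV}$ over $\mathcal U^{\leq 0}$ is the higher inductive family with point constructor $\mathrm{tcon}(c):\mathrm{inV}(X)$ for $c:\mathrm{Ext}(\mathrm{inV})(X)$ and path constructor $\mathrm{uacon}(w_0,w_1):w_0=w_1$ for $X$ with $P(X)$ and $w_0,w_1:\mathrm{inV}(X)$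 (vacuous when $P$ is constantly false). -}

{-# OPTIONS --without-K #-}
module Defs where

open import Level using (Level; _⊔_; 0ℓ; Setω) renaming (suc to lsuc)
open import Data.Product using (Σ; Σ-syntax; _,_; proj₁; proj₂; _×_)
open import Relation.Binary.PropositionalEquality using (_≡_; refl; subst)

isProp : ∀ {a} → Set a → Set a
isProp A = (x y : A) → x ≡ y

isSet : ∀ {a} → Set a → Set a
isSet A = (x y : A) → isProp (x ≡ y)

isContr : ∀ {a} → Set a → Set a
isContr A = Σ A λ c → (x : A) → c ≡ x

fiber : ∀ {a b} {A : Set a} {B : Set b} → (A → B) → B → Set (a ⊔ b)
fiber {A = A} f y = Σ A λ x → f x ≡ y

isEquiv : ∀ {a b} {A : Set a} {B : Set b} → (A → B) → Set (a ⊔ b)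
isEquiv {B = B} f = (y : B) → isContr (fiber f y)

_≃_ : ∀ {a b} → Set a → Set b → Set (a ⊔ b)
A ≃ B = Σ (A → B) isEquiv

happly : ∀ {a b} {A : Set a} {B : A → Set b} {f g : (x : A) → B x} →
         f ≡ g → (x : A) → f x ≡ g x
happly refl x = refl

FunExt : Setω
FunExt = ∀ {a b} {A : Set a} {B : A → Set b} (f g : (x : A) → B x) →
         isEquiv (happly {A = A} {B = B} {f = f} {g = g})

U0 : Set₁
U0 = Σ Set isSet

El : U0 → Set
El = proj₁

idToEquiv-refl : (A : Set) → A ≃ A
idToEquiv-refl A = (λ x → x) , λ y → (y , refl) , λ { (x , refl) → refl }

idtoeqv : {X Y : U0} → X ≡ Y → El X ≃ El Y
idtoeqv {X} refl = idToEquiv-refl (El X)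

Univalent : Set₁
Univalent = (X Y : U0) → isEquiv (idtoeqv {X} {Y})

record Container (ℓs ℓp : Level) : Set (lsuc (ℓs ⊔ ℓp) ⊔ lsuc 0ℓ) where
  field
    S   : U0 → Set ℓs
    Pos : (i : U0) → S i → U0 → Set ℓp
open Container public

lvl : Level → Level → Level
lvl ℓs ℓp = lsuc 0ℓ ⊔ ℓs ⊔ ℓp

Ext : ∀ {ℓs ℓp ℓ} (C : Container ℓs ℓp) → (U0 → Set ℓ) → U0 → Set (lvl ℓs ℓp ⊔ ℓ)
Ext C F i = Σ (S C i) λ s → (j : U0) → Pos C i s j → F j

-- The container retains 0-truncation (families F range over the universe Set (lvl ℓs ℓp),
-- the universe in which inV lives)
RetainsSet : ∀ {ℓs ℓp} → Container ℓs ℓp → Set (lsuc (lvl ℓs ℓp))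
RetainsSet {ℓs} {ℓp} C =
  (F : U0 → Set (lvl ℓs ℓp)) (i₀ i₁ : U0) (s₀ : S C i₀) (s₁ : S C i₁)
  (t₀ : (j : U0) → Pos C i₀ s₀ j → F j) (t₁ : (j : U0) → Pos C i₁ s₁ j → F j) →
  ((j₀ j₁ : U0) (p₀ : Pos C i₀ s₀ j₀) (p₁ : Pos C i₁ s₁ j₁) →
     isProp (Σ (j₀ ≡ j₁) λ q → subst F q (t₀ j₀ p₀) ≡ t₁ j₁ p₁)) →
  isProp (_≡_ {A = Σ U0 (Ext C F)} (i₀ , s₀ , t₀) (i₁ , s₁ , t₁))

-- inV for P = λ X. ⊥ : the path constructor uacon is vacuous, so inV is the
-- ordinary inductive family with the single point constructor tcon.
data inV {ℓs ℓp} (C : Container ℓs ℓp) : U0 → Set (lvl ℓs ℓp) where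
  tcon : {X : U0} → Ext C (inV C) X → inV C X

V : ∀ {ℓs ℓp} → Container ℓs ℓp → Set (lvl ℓs ℓp)
V C = Σ U0 (inV C)

{-# OPTIONS --without-K #-}
-- For P = λ X. ⊥ the path constructor of inV is vacuous, so inV is the
-- ordinary inductive family generated by tcon, and unfolding one layer
--   unfold : V → Σ (X : U⁰) Ext(inV)(X),   (X , tcon e) ↦ (X , e)
-- has the inverse fold. The proof is a single induction on w : inV(X)
-- showing that every identity type (X , w) ≡ b in V is a proposition:
--   * the children t j p of w satisfy this by induction, and a pair-of-paths
--     type Σ (q : j₀ ≡ j₁) (subst q u ≡ v) is a retract of (j₀ , u) ≡ (j₁ , v),
--     so the hypothesis of "retains 0-truncation" holds for F = inV;
--   * hence paths in Σ Ext(inV) between the unfolded points are propositional,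
--     and (X , w) ≡ b is a retract of that path type, since fold ∘ unfold = id.
-- Everything rests on two general facts about retracts: retracts of
-- propositions are propositions, and a retraction lifts to identity types.
module Submission where

open import Level using (_⊔_)
open import Defs
open import Data.Product using (Σ; _,_; proj₁; proj₂)
open import Relation.Binary.PropositionalEquality
  using (_≡_; refl; subst; cong; sym; trans)
open import Relation.Binary.PropositionalEquality.Properties using (trans-symˡ)

record Retract {a b} (A : Set a) (B : Set b) : Set (a ⊔ b) where
  field
    section    : A → B
    retraction : B → A
    retract    : (x : A) → retraction (section x) ≡ x
open Retract

retract-isProp : ∀ {a b} {A : Set a} {B : Set b} →
  Retract A B → isProp B → isProp A
retract-isProp R propB x y =
  trans (sym (retract R x))
        (trans (cong (retraction R) (propB (section R x) (section R y)))
               (retract R y))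

-- If A is a retract of B then x ≡ y is a retract of section x ≡ section y:
-- a path p is recovered from cong section p by conjugating cong retraction
-- with the homotopy retraction ∘ section ~ id.
retract-≡ : ∀ {a b} {A : Set a} {B : Set b} (R : Retract A B) {x y : A} →
  Retract (x ≡ y) (section R x ≡ section R y)
retract-≡ R {x} {y} = record
  { section    = cong (section R)
  ; retraction = λ p → trans (sym (retract R x)) (trans (cong (retraction R) p) (retract R y))
  ; retract    = λ { refl → trans-symˡ (retract R x) }
  }

Σ-≡-retract : ∀ {a b} {A : Set a} {B : A → Set b} {u v : Σ A B} →
  Retract (Σ (proj₁ u ≡ proj₁ v) λ q → subst B q (proj₂ u) ≡ proj₂ v) (u ≡ v)
Σ-≡-retract = record
  { section    = λ { (refl , refl) → refl }
  ; retraction = λ { refl → refl , refl }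
  ; retract    = λ { (refl , refl) → refl }
  }

module _ {ℓs ℓp} (C : Container ℓs ℓp) (retainsSet : RetainsSet C) where

  V-unfolded : Set (lvl ℓs ℓp)
  V-unfolded = Σ U0 (Ext C (inV C))

  V-retract-unfolded : Retract (V C) V-unfolded
  V-retract-unfolded = record
    { section    = λ { (X , tcon e) → X , e }
    ; retraction = λ { (X , e) → X , tcon e }
    ; retract    = λ { (X , tcon e) → refl }
    }

  V-≡-isProp : ∀ {X} (w : inV C X) (b : V C) → isProp ((X , w) ≡ b)
  V-≡-isProp {X} (tcon (s , t)) (Y , tcon (s' , t')) =
    retract-isProp (retract-≡ V-retract-unfolded)
      (retainsSet (inV C) X Y s s' t t' children-≡-isProp)
    where
      children-≡-isProp : (j₀ j₁ : U0) (p₀ : Pos C X s j₀) (p₁ : Pos C Y s' j₁) →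
        isProp (Σ (j₀ ≡ j₁) λ q → subst (inV C) q (t j₀ p₀) ≡ t' j₁ p₁)
      children-≡-isProp j₀ j₁ p₀ p₁ =
        retract-isProp Σ-≡-retract (V-≡-isProp (t j₀ p₀) (j₁ , t' j₁ p₁))

corollary3p14 : FunExt → Univalent → ∀ {ℓs ℓp} (C : Container ℓs ℓp) →
    RetainsSet C → isSet (V C)
corollary3p14 _ _ C retainsSet (X , w) = V-≡-isProp C retainsSet w
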